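{- If $G$ is an $n$-vertex graph with minimum degree at least $n/2$, then $rc(G)\le 3$.
   Context: An edge-colored graph is rainbow connected if any two vertices are joined by a path whose edges have pairwise distinct colors. For a connected graph $G$, the rainbow connection $rc(G)$ is the smallest number of colors in an edge coloring of $G$ that makes $G$ rainbow connected. (A graph with minimum degree at least $n/2$ is connected.) -}

module Defs where

open import Data.Nat using (ℕ; _*_; _≤_)
open import Data.Fin using (Fin)
open import Data.Bool using (Bool; true; false)
open import Data.List using (List; []; _∷_; length; filterᵇ; allFin)
open import Data.List.Relation.Unary.Unique.Propositional using (Unique)
open import Data.Product using (Σ; _×_; _,_)
open import Relation.Binary.PropositionalEquality using (_≡_)

record Graph (n : ℕ) : Set where
  field
    adj    : Fin n → Fin n → Bool
    sym    : ∀ i j → adj i j ≡ adj j i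
    irrefl : ∀ i → adj i i ≡ false
open Graph public

degree : ∀ {n} → Graph n → Fin n → ℕ
degree G i = length (filterᵇ (adj G i) (allFin _))

MinDegreeAtLeastHalf : ∀ {n} → Graph n → Set
MinDegreeAtLeastHalf {n} G = ∀ v → n ≤ 2 * degree G v

data Walk {n} (G : Graph n) : Fin n → Fin n → Set where
  [] : ∀ {u} → Walk G u u
  step : ∀ {u w v} → adj G u w ≡ true → Walk G w v → Walk G u v

vertices : ∀ {n} {G : Graph n} {u v} → Walk G u v → List (Fin n)
vertices {u = u} [] = u ∷ []
vertices {u = u} (step _ p) = u ∷ vertices p

EdgeColouring : ∀ {n} → Graph n → ℕ → Set
EdgeColouring {n} G k = Σ (Fin n → Fin n → Fin k) λ c → ∀ i j → c i j ≡ c j i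

colours : ∀ {n} {G : Graph n} {k} → EdgeColouring G k → ∀ {u v} → Walk G u v → List (Fin k)
colours c [] = []
colours (c , s) {u = u} (step {w = w} _ p) = c u w ∷ colours (c , s) p

IsRainbowPath : ∀ {n} {G : Graph n} {k} → EdgeColouring G k → ∀ {u v} → Walk G u v → Set
IsRainbowPath c p = Unique (vertices p) × Unique (colours c p)

RainbowConnected : ∀ {n} {G : Graph n} {k} → EdgeColouring G k → Set
RainbowConnected {n} {G} c = ∀ (u v : Fin n) → Σ (Walk G u v) λ p → IsRainbowPath c p

rc≤ : ∀ {n} → Graph n → ℕ → Set
rc≤ G k = Σ (EdgeColouring G k) (λ c → RainbowConnected {G = G} c)

-- A vertex count shows that two non-adjacent vertices u, v have at least two common
-- neighbours and, when u and v are both unmatched by a matching σ, an edge x v with σ x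
-- adjacent to u; relinking along u, σ x, x, v matches more vertices, so G has a matching
-- leaving at most one vertex unmatched. Colour matching edges 0 and every other edge 1 or 2
-- according to whether its ends lie on the same side, where the side of a vertex records
-- whether it is smaller than its partner, so that partners lie on opposite sides.
-- Non-adjacent vertices on opposite sides are joined through a common neighbour. If u and v
-- lie on the same side, one of them, say u, is matched; its partner u′ lies on the side
-- opposite to v, and the matching edge u u′ followed by u′ v, or by u′ z v for a common
-- neighbour z ≠ σ v, is rainbow.

module Submission where

open import Defs hiding (sym)

open import Data.Bool using (Bool; true; false; _∧_; _∨_; not; if_then_else_)
open import Data.Bool.Properties using (∨-zeroʳ) renaming (_≟_ to _≟ᵇ_)
open import Data.Empty using (⊥-elim)
open import Data.Fin using (Fin; zero; suc; _≟_)
import Data.Fin.Permutation as Perm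
open import Data.Fin.Patterns using (0F; 1F; 2F)
open import Data.Fin.Properties using (any?; _<?_; <-cmp)
open import Data.List as List using (List; []; _∷_; length; filterᵇ; tabulate; drop; _ʳ++_)
open import Data.List.Relation.Unary.All using ([]; _∷_)
open import Data.List.Relation.Unary.AllPairs using ([]; _∷_)
open import Data.List.Relation.Unary.Unique.Propositional using (Unique)
open import Data.Nat using (ℕ; zero; suc; _+_; _*_; _≤_; _<_; z≤n; s≤s)
open import Data.Nat.Properties
  using ( ≤-refl; ≤-reflexive; ≤-trans; <-≤-trans; ≤-pred; m≤m+n; +-comm; +-identityʳ
        ; +-mono-≤; +-monoˡ-≤; +-monoʳ-≤; +-cancelˡ-≤; +-cancelʳ-<; *-cancelˡ-≤; *-distribˡ-+
        ; +-0-commutativeMonoid; module ≤-Reasoning )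
open import Algebra.Properties.CommutativeMonoid.Sum +-0-commutativeMonoid
  using (sum; sum-cong-≗; ∑-distrib-+; sum-permute)
open import Data.Product using (Σ; ∃; _×_; _,_; proj₁; proj₂)
open import Data.Sum using (_⊎_; inj₁; inj₂; [_,_]′)
open import Function using (_∘_)
open import Relation.Binary.Definitions using (tri<; tri≈; tri>)
open import Relation.Binary.PropositionalEquality
open import Relation.Nullary using (does; yes; no; ¬?; _×-dec_)
open import Relation.Nullary.Decidable using (dec-true; dec-false)

indicator : Bool → ℕ
indicator true  = 1
indicator false = 0

count : ∀ {n} → (Fin n → Bool) → ℕ
count P = sum (indicator ∘ P)

indicator-mono : ∀ {a b} → (a ≡ true → b ≡ true) → indicator a ≤ indicator b
indicator-mono {false} a⇒b = z≤n
indicator-mono {true}  a⇒b rewrite a⇒b refl = ≤-refl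

sum-mono-≤ : ∀ {n} {f g : Fin n → ℕ} → (∀ x → f x ≤ g x) → sum f ≤ sum g
sum-mono-≤ {zero}  f≤g = z≤n
sum-mono-≤ {suc n} f≤g = +-mono-≤ (f≤g zero) (sum-mono-≤ (f≤g ∘ suc))

length-filterᵇ-tabulate : ∀ {n} {A : Set} (P : A → Bool) (f : Fin n → A) →
                          length (filterᵇ P (tabulate f)) ≡ count (P ∘ f)
length-filterᵇ-tabulate {zero}  P f = refl
length-filterᵇ-tabulate {suc n} P f with P (f zero)
... | true  = cong suc (length-filterᵇ-tabulate P (f ∘ suc))
... | false = length-filterᵇ-tabulate P (f ∘ suc)

count-all : ∀ n → count {n} (λ _ → true) ≡ n
count-all zero    = refl
count-all (suc n) = cong suc (count-all n)

count-none : ∀ n → count {n} (λ _ → false) ≡ 0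
count-none zero    = refl
count-none (suc n) = count-none n

count-singleton : ∀ {n} (u : Fin n) → count (λ x → does (x ≟ u)) ≡ 1
count-singleton {suc n} zero    = cong suc (count-none n)
count-singleton {suc n} (suc u) = count-singleton u

count>0⇒∃ : ∀ {n} P → 0 < count {n} P → ∃ λ x → P x ≡ true
count>0⇒∃ {suc n} P pos with P zero in P0
... | true  = zero , P0
... | false = let x , Px = count>0⇒∃ (P ∘ suc) pos in suc x , Px

module _ {n : ℕ} where

  _⊆_ : (Fin n → Bool) → (Fin n → Bool) → Set
  P ⊆ Q = ∀ x → P x ≡ true → Q x ≡ true

  count-mono : ∀ {P Q} → P ⊆ Q → count P ≤ count Q
  count-mono P⊆Q = sum-mono-≤ (λ x → indicator-mono (P⊆Q x))

  count-< : ∀ {P Q} u → P ⊆ Q → P u ≡ false → Q u ≡ true → count P < count Q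
  count-< {P} {Q} u P⊆Q Pu Qu = begin
    1 + count P
      ≡⟨ cong (_+ count P) (count-singleton u) ⟨
    count (λ x → does (x ≟ u)) + count P
      ≡⟨ ∑-distrib-+ (λ x → indicator (does (x ≟ u))) (indicator ∘ P) ⟨
    sum (λ x → indicator (does (x ≟ u)) + indicator (P x))
      ≤⟨ sum-mono-≤ pointwise ⟩
    count Q
      ∎
    where
    open ≤-Reasoning
    pointwise : ∀ x → indicator (does (x ≟ u)) + indicator (P x) ≤ indicator (Q x)
    pointwise x with x ≟ u
    ... | yes refl rewrite Pu | Qu = ≤-refl
    ... | no _     = indicator-mono (P⊆Q x)

  count≤n : ∀ (P : Fin n → Bool) → count P ≤ n
  count≤n P = ≤-trans (count-mono {P} {λ _ → true} (λ _ _ → refl)) (≤-reflexive (count-all n))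

  count-insert : ∀ P u → P u ≡ false → count P < count (λ x → P x ∨ does (x ≟ u))
  count-insert P u Pu = count-< {P} u (λ x Px → cong (_∨ _) Px) Pu
    (trans (cong (P u ∨_) (dec-true (u ≟ u) refl)) (∨-zeroʳ (P u)))

  2+count≤n : ∀ {P u v} → u ≢ v → P u ≡ false → P v ≡ false → 2 + count P ≤ n
  2+count≤n {P} {u} {v} u≢v Pu Pv = begin
    2 + count P                                          ≤⟨ s≤s (count-insert P u Pu) ⟩
    1 + count (λ x → P x ∨ does (x ≟ u))                 ≤⟨ count-insert _ v P∨u[v] ⟩
    count (λ x → (P x ∨ does (x ≟ u)) ∨ does (x ≟ v))    ≤⟨ count≤n _ ⟩
    n                                                    ∎
    where
    open ≤-Reasoning
    P∨u[v] : P v ∨ does (v ≟ u) ≡ false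
    P∨u[v] rewrite Pv = dec-false (v ≟ u) (≢-sym u≢v)

  count-∨+count-∧ : ∀ (P Q : Fin n → Bool) →
                    count P + count Q ≡ count (λ x → P x ∨ Q x) + count (λ x → P x ∧ Q x)
  count-∨+count-∧ P Q = begin
    count P + count Q
      ≡⟨ ∑-distrib-+ (indicator ∘ P) (indicator ∘ Q) ⟨
    sum (λ x → indicator (P x) + indicator (Q x))
      ≡⟨ sum-cong-≗ (λ x → pointwise (P x) (Q x)) ⟩
    sum (λ x → indicator (P x ∨ Q x) + indicator (P x ∧ Q x))
      ≡⟨ ∑-distrib-+ (λ x → indicator (P x ∨ Q x)) (λ x → indicator (P x ∧ Q x)) ⟩
    count (λ x → P x ∨ Q x) + count (λ x → P x ∧ Q x)
      ∎
    where
    open ≡-Reasoning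
    pointwise : ∀ a b → indicator a + indicator b ≡ indicator (a ∨ b) + indicator (a ∧ b)
    pointwise false false = refl
    pointwise false true  = refl
    pointwise true  false = refl
    pointwise true  true  = refl

  count-∘-involution : ∀ (P : Fin n → Bool) (σ : Fin n → Fin n) → (∀ x → σ (σ x) ≡ x) →
                       count (P ∘ σ) ≡ count P
  count-∘-involution P σ σσ≡id = sym (sum-permute (indicator ∘ P) (Perm.permutation σ σ σσ≡id σσ≡id))

  count>1⇒∃≢ : ∀ (P : Fin n → Bool) → 1 < count P → ∀ y → ∃ λ x → P x ≡ true × x ≢ y
  count>1⇒∃≢ P two y with count>0⇒∃ P-y (+-cancelʳ-< 1 0 (count P-y) (<-≤-trans two count-P≤))
    where
    P-y : Fin n → Bool
    P-y x = P x ∧ not (does (x ≟ y))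
    is-y : Fin n → Bool
    is-y x = does (x ≟ y)
    P⊆P-y∨y : P ⊆ (λ x → P-y x ∨ is-y x)
    P⊆P-y∨y x Px with x ≟ y
    ... | yes _ = ∨-zeroʳ _
    ... | no _  rewrite Px = refl
    count-P≤ : count P ≤ count P-y + 1
    count-P≤ = begin
      count P                                                      ≤⟨ count-mono P⊆P-y∨y ⟩
      count (λ x → P-y x ∨ is-y x)                                 ≤⟨ m≤m+n _ _ ⟩
      count (λ x → P-y x ∨ is-y x) + count (λ x → P-y x ∧ is-y x)  ≡⟨ count-∨+count-∧ P-y is-y ⟨
      count P-y + count is-y                                       ≡⟨ cong (count P-y +_) (count-singleton y) ⟩
      count P-y + 1                                                ∎
      where open ≤-Reasoning
  ... | x , P-y[x] with P x in Px | x ≟ y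
  ...   | true | no x≢y = x , Px , x≢y

∧-true : ∀ {a b} → a ∧ b ≡ true → a ≡ true × b ≡ true
∧-true {true} {true} _ = refl , refl

m≤2a⇒m≤2b⇒m≤a+b : ∀ {m a b} → m ≤ 2 * a → m ≤ 2 * b → m ≤ a + b
m≤2a⇒m≤2b⇒m≤a+b {m} {a} {b} m≤2a m≤2b = *-cancelˡ-≤ 2 (begin
  2 * m          ≡⟨ cong (m +_) (+-identityʳ m) ⟩
  m + m          ≤⟨ +-mono-≤ m≤2a m≤2b ⟩
  2 * a + 2 * b  ≡⟨ *-distribˡ-+ 2 a b ⟨
  2 * (a + b)    ∎)
  where open ≤-Reasoning

module _ {n : ℕ} (G : Graph n) where

  adj⇒≢ : ∀ {x y} → adj G x y ≡ true → x ≢ y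
  adj⇒≢ {x} xy refl with () ← trans (sym (irrefl G x)) xy

  degree≡count : ∀ v → degree G v ≡ count (adj G v)
  degree≡count v = length-filterᵇ-tabulate (adj G v) (λ x → x)

  record IsMatching (σ : Fin n → Fin n) : Set where
    field
      involutive  : ∀ x → σ (σ x) ≡ x
      adj-partner : ∀ x → σ x ≢ x → adj G x (σ x) ≡ true

  IsNearPerfect : (Fin n → Fin n) → Set
  IsNearPerfect σ = ∀ x y → σ x ≡ x → σ y ≡ y → x ≡ y

  -- Matches a with b and leaves the former partners σ a and σ b unmatched.
  link : Fin n → Fin n → (Fin n → Fin n) → Fin n → Fin n
  link a b σ x with x ≟ a | x ≟ b | x ≟ σ a | x ≟ σ b
  ... | yes _ | _     | _     | _     = b
  ... | no _  | yes _ | _     | _     = a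
  ... | no _  | no _  | yes _ | _     = x
  ... | no _  | no _  | no _  | yes _ = x
  ... | no _  | no _  | no _  | no _  = σ x

  link-a : ∀ a b σ → link a b σ a ≡ b
  link-a a b σ with a ≟ a
  ... | yes _   = refl
  ... | no a≢a = ⊥-elim (a≢a refl)

  module _ {a b : Fin n} {σ : Fin n → Fin n} where

    link-b : a ≢ b → link a b σ b ≡ a
    link-b a≢b with b ≟ a | b ≟ b
    ... | yes b≡a | _       = ⊥-elim (a≢b (sym b≡a))
    ... | no _    | yes _   = refl
    ... | no _    | no b≢b = ⊥-elim (b≢b refl)

    link-old-partner : ∀ {x} → x ≢ a → x ≢ b → x ≡ σ a ⊎ x ≡ σ b → link a b σ x ≡ x
    link-old-partner {x} x≢a x≢b x∈σ[ab] with x ≟ a | x ≟ b | x ≟ σ a | x ≟ σ b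
    ... | yes x≡a | _       | _     | _      = ⊥-elim (x≢a x≡a)
    ... | no _    | yes x≡b | _     | _      = ⊥-elim (x≢b x≡b)
    ... | no _    | no _    | yes _ | _      = refl
    ... | no _    | no _    | no _  | yes _  = refl
    ... | no _    | no _    | no x≢σa | no x≢σb = ⊥-elim ([ x≢σa , x≢σb ]′ x∈σ[ab])

    link-other : ∀ {x} → x ≢ a → x ≢ b → x ≢ σ a → x ≢ σ b → link a b σ x ≡ σ x
    link-other {x} x≢a x≢b x≢σa x≢σb with x ≟ a | x ≟ b | x ≟ σ a | x ≟ σ b
    ... | yes x≡a | _        | _         | _         = ⊥-elim (x≢a x≡a)
    ... | no _    | yes x≡b  | _         | _         = ⊥-elim (x≢b x≡b)
    ... | no _    | no _     | yes x≡σa  | _         = ⊥-elim (x≢σa x≡σa)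
    ... | no _    | no _     | no _      | yes x≡σb  = ⊥-elim (x≢σb x≡σb)
    ... | no _    | no _     | no _      | no _      = refl

  unmatched : (Fin n → Fin n) → Fin n → Bool
  unmatched σ x = does (σ x ≟ x)

  Improvement : (Fin n → Fin n) → Fin n → Set
  Improvement σ u = ∃ λ τ → IsMatching τ × (∀ x → τ x ≡ x → σ x ≡ x) × τ u ≢ u

  module _ {σ : Fin n → Fin n} (σ-matching : IsMatching σ) where
    open IsMatching σ-matching

    σ-swap : ∀ {x y} → σ x ≡ y → x ≡ σ y
    σ-swap {x} σx≡y = trans (sym (involutive x)) (cong σ σx≡y)

    σ-injective : ∀ {x y} → σ x ≡ σ y → x ≡ y
    σ-injective {y = y} σx≡σy = trans (σ-swap σx≡σy) (involutive y)

    link-isMatching : ∀ {a b} → adj G a b ≡ true → IsMatching (link a b σ)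
    link-isMatching {a} {b} ab = record { involutive = link-involutive ; adj-partner = link-adj-partner }
      where
      link-involutive : ∀ x → link a b σ (link a b σ x) ≡ x
      link-involutive x with x ≟ a | x ≟ b | x ≟ σ a | x ≟ σ b
      ... | yes refl | _        | _        | _        = link-b (adj⇒≢ ab)
      ... | no _     | yes refl | _        | _        = link-a a b σ
      ... | no x≢a   | no x≢b   | yes x≡σa | _        = link-old-partner x≢a x≢b (inj₁ x≡σa)
      ... | no x≢a   | no x≢b   | no _     | yes x≡σb = link-old-partner x≢a x≢b (inj₂ x≡σb)
      ... | no x≢a   | no x≢b   | no x≢σa  | no x≢σb  = trans
        (link-other (x≢σa ∘ σ-swap) (x≢σb ∘ σ-swap) (x≢a ∘ σ-injective) (x≢b ∘ σ-injective))
        (involutive x)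
      link-adj-partner : ∀ x → link a b σ x ≢ x → adj G x (link a b σ x) ≡ true
      link-adj-partner x moved with x ≟ a | x ≟ b | x ≟ σ a | x ≟ σ b
      ... | yes refl | _        | _     | _     = ab
      ... | no _     | yes refl | _     | _     = trans (Graph.sym G b a) ab
      ... | no _     | no _     | yes _ | _     = ⊥-elim (moved refl)
      ... | no _     | no _     | no _  | yes _ = ⊥-elim (moved refl)
      ... | no _     | no _     | no _  | no _  = adj-partner x moved

    link-fixed : ∀ {a b x} → a ≢ b → link a b σ x ≡ x → x ≢ a × x ≢ b × (σ x ≡ x ⊎ x ≡ σ a ⊎ x ≡ σ b)
    link-fixed {a} {b} {x} a≢b fixed with x ≟ a | x ≟ b | x ≟ σ a | x ≟ σ b
    ... | yes refl | _        | _        | _        = ⊥-elim (a≢b (sym fixed))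
    ... | no _     | yes refl | _        | _        = ⊥-elim (a≢b fixed)
    ... | no x≢a   | no x≢b   | yes x≡σa | _        = x≢a , x≢b , inj₂ (inj₁ x≡σa)
    ... | no x≢a   | no x≢b   | no _     | yes x≡σb = x≢a , x≢b , inj₂ (inj₂ x≡σb)
    ... | no x≢a   | no x≢b   | no _     | no _     = x≢a , x≢b , inj₁ fixed

    link-unmatched : ∀ {a b} → σ a ≡ a → σ b ≡ b → adj G a b ≡ true → Improvement σ a
    link-unmatched {a} {b} σa≡a σb≡b ab =
      link a b σ , link-isMatching ab , fixed⊆ , λ τa≡a → a≢b (trans (sym τa≡a) (link-a a b σ))
      where
      a≢b = adj⇒≢ ab
      fixed⊆ : ∀ x → link a b σ x ≡ x → σ x ≡ x
      fixed⊆ x fixed with link-fixed a≢b fixed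
      ... | _   , _   , inj₁ σx≡x        = σx≡x
      ... | x≢a , _   , inj₂ (inj₁ x≡σa) = ⊥-elim (x≢a (trans x≡σa σa≡a))
      ... | _   , x≢b , inj₂ (inj₂ x≡σb) = ⊥-elim (x≢b (trans x≡σb σb≡b))

  improvement-< : ∀ {σ u} → ((τ , _ , fixed⊆ , τu≢u) : Improvement σ u) → σ u ≡ u →
                  count (unmatched τ) < count (unmatched σ)
  improvement-< {σ} {u} (τ , _ , fixed⊆ , τu≢u) σu≡u =
    count-< u unmatched⊆ (dec-false (τ u ≟ u) τu≢u) (dec-true (σ u ≟ u) σu≡u)
    where
    unmatched⊆ : unmatched τ ⊆ unmatched σ
    unmatched⊆ x τx with τ x ≟ x
    ... | yes τx≡x = dec-true (σ x ≟ x) (fixed⊆ x τx≡x)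

  augment : ∀ {σ} → IsMatching σ → ∀ {u v x} → σ u ≡ u → σ v ≡ v → u ≢ v → σ x ≢ x →
            adj G u (σ x) ≡ true → adj G v x ≡ true → Improvement σ u
  augment {σ} σ-matching {u} {v} {x} σu≡u σv≡v u≢v σx≢x ua vx =
    τ , link-isMatching ρ-matching vx , τ-fixed⇒σ-fixed , τ-moves-u
    where
    open IsMatching σ-matching
    a = σ x
    ρ = link u a σ
    ρ-matching = link-isMatching σ-matching ua
    τ = link v x ρ
    u≢a = adj⇒≢ ua
    v≢x = adj⇒≢ vx
    σa≡x = involutive x
    x≢u : x ≢ u
    x≢u x≡u = σx≢x (trans (cong σ x≡u) (trans σu≡u (sym x≡u)))
    ρx≡x : ρ x ≡ x
    ρx≡x = link-old-partner x≢u (σx≢x ∘ sym) (inj₂ (sym σa≡x))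
    ρv≡v : ρ v ≡ v
    ρv≡v = trans (link-other (u≢v ∘ sym)
                             (λ v≡σx → v≢x (sym (trans (σ-swap σ-matching (sym v≡σx)) σv≡v)))
                             (λ v≡σu → u≢v (sym (trans v≡σu σu≡u)))
                             (λ v≡σa → v≢x (trans v≡σa σa≡x)))
                 σv≡v
    τ-fixed⇒ρ-fixed : ∀ {y} → τ y ≡ y → ρ y ≡ y × y ≢ x
    τ-fixed⇒ρ-fixed fixed with link-fixed ρ-matching v≢x fixed
    ... | _   , y≢x , inj₁ ρy≡y        = ρy≡y , y≢x
    ... | y≢v , _   , inj₂ (inj₁ y≡ρv) = ⊥-elim (y≢v (trans y≡ρv ρv≡v))
    ... | _   , y≢x , inj₂ (inj₂ y≡ρx) = ⊥-elim (y≢x (trans y≡ρx ρx≡x))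
    τ-fixed⇒σ-fixed : ∀ y → τ y ≡ y → σ y ≡ y
    τ-fixed⇒σ-fixed y fixed with τ-fixed⇒ρ-fixed fixed
    ... | ρy≡y , y≢x with link-fixed σ-matching u≢a ρy≡y
    ...   | _   , _ , inj₁ σy≡y        = σy≡y
    ...   | y≢u , _ , inj₂ (inj₁ y≡σu) = ⊥-elim (y≢u (trans y≡σu σu≡u))
    ...   | _   , _ , inj₂ (inj₂ y≡σa) = ⊥-elim (y≢x (trans y≡σa σa≡x))
    τ-moves-u : τ u ≢ u
    τ-moves-u fixed = u≢a (trans (sym (proj₁ (τ-fixed⇒ρ-fixed fixed))) (link-a u a σ))

  module _ (δ≥n/2 : MinDegreeAtLeastHalf G) where

    n≤degree+degree : ∀ u v → n ≤ degree G u + degree G v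
    n≤degree+degree u v = m≤2a⇒m≤2b⇒m≤a+b {n} {degree G u} {degree G v} (δ≥n/2 u) (δ≥n/2 v)

    -- For σ the identity these are the common neighbours of u and v; for a matching σ each such x
    -- gives an augmenting path u, σ x, x, v.
    2≤count-σ-common-neighbours : ∀ (σ : Fin n → Fin n) → (∀ x → σ (σ x) ≡ x) → ∀ {u v} →
      σ u ≡ u → σ v ≡ v → u ≢ v → adj G u v ≡ false →
      2 ≤ count (λ x → adj G u (σ x) ∧ adj G v x)
    2≤count-σ-common-neighbours σ σσ≡id {u} {v} σu≡u σv≡v u≢v u≁v = +-cancelˡ-≤ n 2 _ (begin
      n + 2                            ≡⟨ +-comm n 2 ⟩
      2 + n                            ≤⟨ +-monoʳ-≤ 2 (n≤degree+degree u v) ⟩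
      2 + (degree G u + degree G v)    ≡⟨ cong (2 +_) (cong₂ _+_ degree-u (degree≡count v)) ⟩
      2 + (count P + count Q)          ≡⟨ cong (2 +_) (count-∨+count-∧ P Q) ⟩
      2 + count P∨Q + count P∧Q        ≤⟨ +-monoˡ-≤ (count P∧Q) (2+count≤n u≢v P∨Q[u] P∨Q[v]) ⟩
      n + count P∧Q                    ∎)
      where
      open ≤-Reasoning
      P Q P∨Q P∧Q : Fin n → Bool
      P x = adj G u (σ x)
      Q = adj G v
      P∨Q x = P x ∨ Q x
      P∧Q x = P x ∧ Q x
      degree-u : degree G u ≡ count P
      degree-u = trans (degree≡count u) (sym (count-∘-involution (adj G u) σ σσ≡id))
      P∨Q[u] : P∨Q u ≡ false
      P∨Q[u] rewrite σu≡u | irrefl G u | Graph.sym G v u = u≁v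
      P∨Q[v] : P∨Q v ≡ false
      P∨Q[v] rewrite σv≡v | irrefl G v | u≁v = refl

    improve : ∀ {σ} → IsMatching σ → ∀ {u v} → σ u ≡ u → σ v ≡ v → u ≢ v → Improvement σ u
    improve {σ} σ-matching {u} {v} σu≡u σv≡v u≢v with adj G u v in uv
    ... | true  = link-unmatched σ-matching σu≡u σv≡v uv
    ... | false with count>0⇒∃ _ (≤-trans (s≤s z≤n)
                       (2≤count-σ-common-neighbours σ (IsMatching.involutive σ-matching) σu≡u σv≡v u≢v uv))
    ... | x , linked with ∧-true linked | σ x ≟ x
    ...   | ua , vx | yes σx≡x =
      link-unmatched σ-matching σu≡u σx≡x (subst (λ y → adj G u y ≡ true) σx≡x ua)
    ...   | ua , vx | no σx≢x  = augment σ-matching σu≡u σv≡v u≢v σx≢x ua vx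

    near-perfect-matching : ∃ λ σ → IsMatching σ × IsNearPerfect σ
    near-perfect-matching = grow (suc n) id-matching (s≤s (count≤n _))
      where
      id-matching : IsMatching (λ x → x)
      id-matching = record { involutive = λ _ → refl ; adj-partner = λ _ moved → ⊥-elim (moved refl) }
      grow : ∀ k {σ} → IsMatching σ → count (unmatched σ) < k → ∃ λ σ → IsMatching σ × IsNearPerfect σ
      grow (suc k) {σ} σ-matching <k
        with any? (λ u → any? (λ v → (σ u ≟ u) ×-dec (σ v ≟ v) ×-dec ¬? (u ≟ v)))
      ... | yes (u , v , σu≡u , σv≡v , u≢v) =
        let improvement@(τ , τ-matching , _) = improve σ-matching σu≡u σv≡v u≢v
        in grow k τ-matching (<-≤-trans (improvement-< improvement σu≡u) (≤-pred <k))
      ... | no no-pair = σ , σ-matching , near-perfect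
        where
        near-perfect : IsNearPerfect σ
        near-perfect x y σx≡x σy≡y with x ≟ y
        ... | yes x≡y = x≡y
        ... | no x≢y  = ⊥-elim (no-pair (x , y , σx≡x , σy≡y , x≢y))

Unique-reverse : ∀ {A : Set} {xs : List A} → Unique xs → Unique (List.reverse xs)
Unique-reverse {A} {xs} = Unique-resp-↭ (↭-sym (↭-reverse xs))
  where
  open import Data.List.Relation.Binary.Permutation.Setoid (setoid A) using (↭-sym)
  open import Data.List.Relation.Binary.Permutation.Setoid.Properties (setoid A)
    using (Unique-resp-↭; ↭-reverse)

module _ {n : ℕ} {G : Graph n} where

  reverseOnto : ∀ {u v w} → Walk G u v → Walk G u w → Walk G v w
  reverseOnto []         q = q
  reverseOnto (step e p) q = reverseOnto p (step (trans (Graph.sym G _ _) e) q)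

  reverse : ∀ {u v} → Walk G u v → Walk G v u
  reverse p = reverseOnto p []

  vertices-head : ∀ {u v} (p : Walk G u v) → vertices p ≡ u ∷ drop 1 (vertices p)
  vertices-head []         = refl
  vertices-head (step _ _) = refl

  vertices-reverseOnto : ∀ {u v w} (p : Walk G u v) (q : Walk G u w) →
                         vertices (reverseOnto p q) ≡ drop 1 (vertices p) ʳ++ vertices q
  vertices-reverseOnto []         q = refl
  vertices-reverseOnto (step e p) q =
    trans (vertices-reverseOnto p _) (cong (_ʳ++ vertices q) (sym (vertices-head p)))

  vertices-reverse : ∀ {u v} (p : Walk G u v) → vertices (reverse p) ≡ List.reverse (vertices p)
  vertices-reverse p = trans (vertices-reverseOnto p []) (cong List.reverse (sym (vertices-head p)))

  module _ {k} (c : EdgeColouring G k) where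

    colours-reverseOnto : ∀ {u v w} (p : Walk G u v) (q : Walk G u w) →
                          colours c (reverseOnto p q) ≡ colours c p ʳ++ colours c q
    colours-reverseOnto []                 q = refl
    colours-reverseOnto (step {w = x} e p) q =
      trans (colours-reverseOnto p _) (cong (λ γ → colours c p ʳ++ (γ ∷ colours c q)) (proj₂ c x _))

    reverse-isRainbowPath : ∀ {u v} {p : Walk G u v} → IsRainbowPath c p → IsRainbowPath c (reverse p)
    reverse-isRainbowPath {p = p} (unique-vertices , unique-colours) =
      subst Unique (sym (vertices-reverse p)) (Unique-reverse unique-vertices) ,
      subst Unique (sym (colours-reverseOnto p [])) (Unique-reverse unique-colours)

does-<?-flip : ∀ {n} {x y : Fin n} → x ≢ y → does (x <? y) ≢ does (y <? x)
does-<?-flip {x = x} {y} x≢y with <-cmp x y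
... | tri< x<y _ y≮x rewrite dec-true (x <? y) x<y | dec-false (y <? x) y≮x = λ ()
... | tri≈ _ x≡y _                                                          = ⊥-elim (x≢y x≡y)
... | tri> x≮y _ y<x rewrite dec-false (x <? y) x≮y | dec-true (y <? x) y<x = λ ()

sideColour : Bool → Bool → Fin 3
sideColour false false = 1F
sideColour true  true  = 1F
sideColour false true  = 2F
sideColour true  false = 2F

sideColour-comm : ∀ a b → sideColour a b ≡ sideColour b a
sideColour-comm false false = refl
sideColour-comm false true  = refl
sideColour-comm true  false = refl
sideColour-comm true  true  = refl

sideColour≢0 : ∀ a b → sideColour a b ≢ 0F
sideColour≢0 false false ()
sideColour≢0 false true  ()
sideColour≢0 true  false ()
sideColour≢0 true  true  ()

sideColour-distinct : ∀ {a c} b → a ≢ c → sideColour a b ≢ sideColour b c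
sideColour-distinct {false} {false} _     a≢c _  = a≢c refl
sideColour-distinct {true}  {true}  _     a≢c _  = a≢c refl
sideColour-distinct {false} {true}  false _   ()
sideColour-distinct {false} {true}  true  _   ()
sideColour-distinct {true}  {false} false _   ()
sideColour-distinct {true}  {false} true  _   ()

module _ {n : ℕ} (G : Graph n) {σ : Fin n → Fin n} (σ-matching : IsMatching G σ) where
  open IsMatching σ-matching

  side : Fin n → Bool
  side x = does (x <? σ x)

  side-partner : ∀ x → σ x ≢ x → side (σ x) ≢ side x
  side-partner x σx≢x rewrite involutive x = does-<?-flip σx≢x

  colour : Fin n → Fin n → Fin 3
  colour x y = if does (y ≟ σ x) then 0F else sideColour (side x) (side y)

  colour-comm : ∀ x y → colour x y ≡ colour y x
  colour-comm x y with y ≟ σ x | x ≟ σ y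
  ... | yes _     | yes _     = refl
  ... | yes y≡σx  | no x≢σy   = ⊥-elim (x≢σy (σ-swap G σ-matching (sym y≡σx)))
  ... | no y≢σx   | yes x≡σy  = ⊥-elim (y≢σx (σ-swap G σ-matching (sym x≡σy)))
  ... | no _      | no _      = sideColour-comm (side x) (side y)

  colour-partner : ∀ x → colour x (σ x) ≡ 0F
  colour-partner x rewrite dec-true (σ x ≟ σ x) refl = refl

  colour≢0 : ∀ {x y} → y ≢ σ x → colour x y ≢ 0F
  colour≢0 {x} {y} y≢σx rewrite dec-false (y ≟ σ x) y≢σx = sideColour≢0 (side x) (side y)

  colour-distinct : ∀ {x y} z → x ≢ y → side x ≢ side y → colour x z ≢ colour z y
  colour-distinct {x} {y} z x≢y sides≢ with z ≟ σ x | y ≟ σ z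
  ... | yes z≡σx | yes y≡σz = ⊥-elim (x≢y (trans (σ-swap G σ-matching (sym z≡σx)) (sym y≡σz)))
  ... | yes _    | no _     = sideColour≢0 (side z) (side y) ∘ sym
  ... | no _     | yes _    = sideColour≢0 (side x) (side z)
  ... | no _     | no _     = sideColour-distinct (side z) sides≢

  matchingColouring : EdgeColouring G 3
  matchingColouring = colour , colour-comm

  RainbowPath : Fin n → Fin n → Set
  RainbowPath u v = Σ (Walk G u v) (IsRainbowPath matchingColouring)

  path₁ : ∀ {u v} → adj G u v ≡ true → RainbowPath u v
  path₁ uv = step uv [] , ((adj⇒≢ G uv ∷ []) ∷ [] ∷ []) , ([] ∷ [])

  path₂ : ∀ {u z v} (uz : adj G u z ≡ true) (zv : adj G z v ≡ true) →
          u ≢ v → colour u z ≢ colour z v → RainbowPath u v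
  path₂ uz zv u≢v c₁≢c₂ = step uz (step zv []) ,
    ((adj⇒≢ G uz ∷ u≢v ∷ []) ∷ (adj⇒≢ G zv ∷ []) ∷ [] ∷ []) , ((c₁≢c₂ ∷ []) ∷ [] ∷ [])

  path₃ : ∀ {u a b v} (ua : adj G u a ≡ true) (ab : adj G a b ≡ true) (bv : adj G b v ≡ true) →
          u ≢ b → u ≢ v → a ≢ v →
          colour u a ≢ colour a b → colour u a ≢ colour b v → colour a b ≢ colour b v → RainbowPath u v
  path₃ ua ab bv u≢b u≢v a≢v c₁≢c₂ c₁≢c₃ c₂≢c₃ = step ua (step ab (step bv [])) ,
    ((adj⇒≢ G ua ∷ u≢b ∷ u≢v ∷ []) ∷ (adj⇒≢ G ab ∷ a≢v ∷ []) ∷ (adj⇒≢ G bv ∷ []) ∷ [] ∷ []) ,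
    ((c₁≢c₂ ∷ c₁≢c₃ ∷ []) ∷ (c₂≢c₃ ∷ []) ∷ [] ∷ [])

  module _ (δ≥n/2 : MinDegreeAtLeastHalf G) where

    common-neighbour : ∀ {u v} → u ≢ v → adj G u v ≡ false → ∀ y →
                       ∃ λ z → adj G u z ≡ true × adj G z v ≡ true × z ≢ y
    common-neighbour {u} {v} u≢v u≁v y
      with count>1⇒∃≢ _ (2≤count-σ-common-neighbours G δ≥n/2 (λ x → x) (λ _ → refl) refl refl u≢v u≁v) y
    ... | z , uz∧vz , z≢y with ∧-true uz∧vz
    ...   | uz , vz = z , uz , trans (Graph.sym G z v) vz , z≢y

    across : ∀ {u v} → u ≢ v → adj G u v ≡ false → side u ≢ side v → RainbowPath u v
    across {u} {v} u≢v u≁v sides≢ with common-neighbour u≢v u≁v u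
    ... | z , uz , zv , _ = path₂ uz zv u≢v (colour-distinct z u≢v sides≢)

    via-partner : ∀ {u v} → u ≢ v → adj G u v ≡ false → side u ≡ side v → σ u ≢ u → RainbowPath u v
    via-partner {u} {v} u≢v u≁v sides≡ σu≢u = via (adj G (σ u) v) refl
      where
      uu′ : adj G u (σ u) ≡ true
      uu′ = adj-partner u σu≢u
      sides′≢ : side (σ u) ≢ side v
      sides′≢ sides′≡ = side-partner u σu≢u (trans sides′≡ (sym sides≡))
      u′≢v : σ u ≢ v
      u′≢v = sides′≢ ∘ cong side
      partner≢ : ∀ {x y} → y ≢ σ x → colour u (σ u) ≢ colour x y
      partner≢ y≢σx c≡ = colour≢0 y≢σx (trans (sym c≡) (colour-partner u))
      via : ∀ b → adj G (σ u) v ≡ b → RainbowPath u v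
      via true  u′v = path₂ uu′ u′v u≢v (partner≢ λ v≡σσu → u≢v (sym (trans v≡σσu (involutive u))))
      via false u′≁v with common-neighbour u′≢v u′≁v (σ v)
      ... | z , u′z , zv , z≢σv = path₃ uu′ u′z zv u≢z u≢v u′≢v
        (partner≢ λ z≡σσu → u≢z (sym (trans z≡σσu (involutive u))))
        (partner≢ (z≢σv ∘ σ-swap G σ-matching ∘ sym))
        (colour-distinct z u′≢v sides′≢)
        where
        u≢z : u ≢ z
        u≢z refl with () ← trans (sym u≁v) zv

    rainbow-connected : IsNearPerfect G σ → RainbowConnected {G = G} matchingColouring
    rainbow-connected near-perfect u v with u ≟ v
    ... | yes refl = [] , ([] ∷ []) , []
    ... | no u≢v with adj G u v in uv
    ...   | true  = path₁ uv
    ...   | false with side u ≟ᵇ side v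
    ...     | no sides≢ = across u≢v uv sides≢
    ...     | yes sides≡ with σ u ≟ u | σ v ≟ v
    ...       | no σu≢u  | _        = via-partner u≢v uv sides≡ σu≢u
    ...       | yes _    | no σv≢v  =
      let p , rainbow = via-partner (u≢v ∘ sym) (trans (Graph.sym G v u) uv) (sym sides≡) σv≢v
      in reverse p , reverse-isRainbowPath matchingColouring rainbow
    ...       | yes σu≡u | yes σv≡v = ⊥-elim (u≢v (near-perfect u v σu≡u σv≡v))

corollary1 : (n : ℕ) (G : Graph n) → MinDegreeAtLeastHalf G → rc≤ G 3
corollary1 n G δ≥n/2 =
  let σ , σ-matching , near-perfect = near-perfect-matching G δ≥n/2
  in matchingColouring G σ-matching , rainbow-connected G σ-matching δ≥n/2 near-perfect
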